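{- Let $m\ge 2$ and let $n$ be a multiple of $m$ with $n > 4m^2-6m$. Then every $n$-vertex tournament has an $m$-star-factor.
   Context: A tournament is an orientation of a complete graph. For $m\ge 2$, the $m$-star $S_m$ is the digraph on $m$ vertices consisting of $m-1$ edges with a common tail (the source) and $m-1$ distinct heads. For a tournament $T$ on $n$ vertices with $m \mid n$, an $m$-star-factor of $T$ is a spanning subgraph of $T$ consisting of $n/m$ pairwise vertex-disjoint copies of $S_m$. -}

module Defs where

open import Data.Nat using (ℕ; suc; _*_)
open import Data.Fin using (Fin; zero; suc)
open import Data.Product using (_×_; Σ; _,_)
open import Data.Sum using (_⊎_)
open import Data.Empty using (⊥)
open import Relation.Nullary using (¬_)
open import Relation.Binary.PropositionalEquality using (_≡_)
open import Function.Bundles using (_⤖_; Bijection)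

record Tournament (n : ℕ) : Set₁ where
  field
    E         : Fin n → Fin n → Set
    irrefl    : ∀ u → ¬ E u u
    total     : ∀ u v → ¬ u ≡ v → E u v ⊎ E v u
    antisym   : ∀ u v → E u v → E v u → ⊥
open Tournament public

-- Copy i has vertices place (i , j) for
-- j : Fin m; `place` being a bijection Fin k × Fin m ⤖ Fin (k * m) expresses
-- that each copy has m distinct vertices, copies are pairwise vertex-disjoint,
-- and together they span T.  In copy i, position `source i` is the common tail
-- and every other vertex of the copy is a head of an edge from it (so the copy
-- contains the m - 1 edges of S_m).
record StarFactor (m k : ℕ) (T : Tournament (k * m)) : Set where
  field
    place  : (Fin k × Fin m) ⤖ Fin (k * m)
    source : Fin k → Fin m
    edges  : ∀ (i : Fin k) (j : Fin m) → ¬ j ≡ source i →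
             E T (Bijection.to place (i , source i)) (Bijection.to place (i , j))

-- Write m = p + 1. Since the outdegrees in a tournament on N vertices sum to N(N - 1)/2, some
-- vertex has outdegree at least (N - 1)/2; so while at least 2p vertices remain, a copy of S_m can
-- be split off greedily. Fix such a vertex u of T, with out-neighbourhood A and in-neighbourhood B.
-- Greedily pack B, leaving a set C of fewer than 2p vertices. Each c in C is then absorbed into a
-- star using p vertices of A: either c has p out-neighbours there, or most of the remaining vertices
-- of A beat c, and one of high outdegree among them is the centre of a star having c as a leaf; the
-- bound n > 4m^2 - 6m makes A large enough for this. Greedily pack the rest of A. Fewer than 2p
-- vertices remain, all out-neighbours of u, and since m divides n there are exactly p of them: with
-- u they form the last star.

{-# OPTIONS --safe #-}
module Submission where

open import Defs
open import Data.Fin using (Fin; zero; suc; combine)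
open import Data.Fin.Properties using (_≟_; *↔×)
open import Data.List using (List; []; _∷_; _++_; [_]; length; filter; take; drop; map; concatMap; allFin)
open import Data.List.Properties
  using (length-++; length-take; take++drop≡id; ++-assoc; concatMap-++; filter-reject; partition-defn; length-tabulate)
open import Data.List.Membership.Propositional using (_∈_; find)
open import Data.List.Membership.Propositional.Properties using (∈-∃++; ∈-++⁺ʳ; ∈-filter⁻; ∈-allFin)
open import Data.List.Relation.Binary.Permutation.Propositional
  using (_↭_; ↭-refl; ↭-sym; ↭-trans; ↭-reflexive; prep; swap; ↭⇒↭ₛ; ↭ₛ⇒↭; module PermutationReasoning)
open import Data.List.Relation.Binary.Permutation.Propositional.Properties
  using (↭-length; ∈-resp-↭; filter-↭; shift; shifts; ++⁺ˡ; ++⁺ʳ; ++-comm)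
import Data.List.Relation.Binary.Permutation.Setoid.Properties as ↭ₛ
open import Data.List.Relation.Binary.Subset.Propositional using (_⊆_)
open import Data.List.Relation.Unary.All as All using (All; []; _∷_)
open import Data.List.Relation.Unary.All.Properties using (¬Any⇒All¬; all-filter; take⁺; anti-mono)
open import Data.List.Relation.Unary.AllPairs using ([]; _∷_)
open import Data.List.Relation.Unary.Any using (any?)
open import Data.List.Relation.Unary.Unique.Propositional using (Unique)
import Data.List.Relation.Unary.Unique.Propositional.Properties as Unique
open import Data.Nat using (ℕ; zero; suc; _+_; _*_; _≤_; _<_; _≥_; _>_; _≤?_; _<?_; z≤n; s≤s)
open import Data.Nat.ListAction using (sum)
open import Data.Nat.Induction using (<-wellFounded)
open import Data.Nat.Properties
  using (*-cancelˡ-≤; *-distribˡ-+; *-monoʳ-≤; *-monoˡ-≤; +-assoc; +-cancelʳ-≤; +-cancelˡ-≡; +-cancelˡ-≤;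
         +-identityʳ; +-mono-≤; +-monoʳ-≤; +-monoˡ-≤; <⇒≱; m≤m+n; m≤n+m; m≤n⇒m⊓n≡m; n≤1+n; suc-injective;
         ≤-pred; ≤-reflexive; ≤-trans; ≤⇒≯; ≮⇒≥; ≰⇒>; +-commutativeSemigroup; module ≤-Reasoning)
open import Algebra.Properties.CommutativeSemigroup +-commutativeSemigroup using (interchange)
open import Data.Nat.Tactic.RingSolver using (solve-∀)
open import Data.Product using (Σ; ∃; ∃₂; _×_; _,_; map₂)
open import Data.Sum using (inj₁; inj₂)
open import Data.Vec as Vec using (Vec; lookup; concat; toList; fromList; cast)
open import Data.Vec.Properties using (toList-cast; toList∘fromList; toList-++; lookup-concat; lookup-map)
import Data.Vec.Membership.Propositional.Properties as Vec∈
import Data.Vec.Relation.Unary.All as VecAll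
import Data.Vec.Relation.Unary.All.Properties as VecAll
open import Data.Vec.Relation.Unary.Any using (index)
open import Data.Vec.Relation.Unary.AllPairs using ([]; _∷_)
open import Data.Vec.Relation.Unary.Any.Properties using (lookup-index)
import Data.Vec.Relation.Unary.Unique.Propositional as Vec
import Data.Vec.Relation.Unary.Unique.Propositional.Properties as VecUnique
open import Function using (_∘_; id)
open import Function.Bundles using (_⤖_; mk⤖)
open import Function.Construct.Composition using (_⤖-∘_)
open import Function.Construct.Symmetry using (↔-sym)
open import Function.Properties.Inverse using (↔⇒⤖)
open import Induction.WellFounded using (Acc; acc)
open import Relation.Binary.Definitions using (Decidable)
import Relation.Binary.PropositionalEquality as ≡
open import Relation.Binary.PropositionalEquality
  using (_≡_; _≢_; refl; sym; trans; cong; cong₂; subst; subst₂; module ≡-Reasoning)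
open import Relation.Nullary using (Dec; yes; no; contradiction)
open import Relation.Unary.Properties using (∁?)

2*m≤1+2*n⇒m≤n : ∀ {m n} → 2 * m ≤ suc (2 * n) → m ≤ n
2*m≤1+2*n⇒m≤n {m} {n} h = ≮⇒≥ λ n<m → <⇒≱ (subst (_≤ 2 * m) (double-suc n) (*-monoʳ-≤ 2 n<m)) h
  where
  double-suc : ∀ n → 2 * suc n ≡ suc (suc (2 * n))
  double-suc = solve-∀

one-star-left : ∀ p s k g → suc (s * suc p + g) ≡ k * suc p → g < 2 * p → g ≡ p × suc s ≡ k
one-star-left p zero zero g () _
one-star-left p zero (suc zero) g eq _ = suc-injective (trans eq (+-identityʳ (suc p))) , refl
one-star-left p zero (suc (suc k)) g eq g<2p = contradiction 2p≤g (<⇒≱ g<2p)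
  where
  open ≤-Reasoning
  2p≤g : 2 * p ≤ g
  2p≤g = begin
    2 * p                     ≡⟨ cong (p +_) (+-identityʳ p) ⟩
    p + p                     ≤⟨ +-monoʳ-≤ p (≤-trans (n≤1+n p) (m≤m+n (suc p) _)) ⟩
    p + (suc p + k * suc p)   ≡⟨ suc-injective eq ⟨
    g                         ∎
one-star-left p (suc s) zero g () _
one-star-left p (suc s) (suc k) g eq g<2p =
  map₂ (cong suc) (one-star-left p s k g (+-cancelˡ-≡ (suc p) _ _ (trans (regroup (suc p) (s * suc p) g) eq)) g<2p)
  where
  regroup : ∀ m a g → m + suc (a + g) ≡ suc ((m + a) + g)
  regroup = solve-∀

absorption-room : ∀ p k a → 4 * (suc p * suc p) < k * suc p + 6 * suc p →
                  k * suc p ≤ suc (2 * a) → (1 + 2 * p) * p ≤ a + 2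
absorption-room p k a hyp hk = *-cancelˡ-≤ 2 (begin
  2 * (suc (2 * p) * p)            ≡⟨ square p ⟩
  4 * (p * p) + 2 * p              ≤⟨ +-cancelʳ-≤ (6 * p + 4) _ _ bound ⟩
  2 * a + 2                        ≤⟨ +-monoʳ-≤ (2 * a) (m≤m+n 2 2) ⟩
  2 * a + 4                        ≡⟨ *-distribˡ-+ 2 a 2 ⟨
  2 * (a + 2)                      ∎)
  where
  open ≤-Reasoning
  square : ∀ p → 2 * (suc (2 * p) * p) ≡ 4 * (p * p) + 2 * p
  square = solve-∀
  expand-square : ∀ p → 4 * (suc p * suc p) ≡ (4 * (p * p) + 2 * p) + (6 * p + 4)
  expand-square = solve-∀
  expand-linear : ∀ p a → 2 * a + 6 * suc p ≡ (2 * a + 2) + (6 * p + 4)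
  expand-linear = solve-∀
  bound : (4 * (p * p) + 2 * p) + (6 * p + 4) ≤ (2 * a + 2) + (6 * p + 4)
  bound = subst₂ _≤_ (expand-square p) (expand-linear p a)
            (≤-pred (≤-trans hyp (+-monoˡ-≤ (6 * suc p) hk)))

most-are-in-neighbours : ∀ q i o → 3 * suc q ≤ (i + o) + 2 → o ≤ q → suc (2 * q) ≤ i
most-are-in-neighbours q i o room o≤q = +-cancelʳ-≤ (q + 2) _ _ (begin
  suc (2 * q) + (q + 2)   ≡⟨ regroup q ⟩
  3 * suc q               ≤⟨ room ⟩
  (i + o) + 2             ≤⟨ +-monoˡ-≤ 2 (+-monoʳ-≤ i o≤q) ⟩
  (i + q) + 2             ≡⟨ +-assoc i q 2 ⟩
  i + (q + 2)             ∎)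
  where
  open ≤-Reasoning
  regroup : ∀ q → suc (2 * q) + (q + 2) ≡ 3 * suc q
  regroup = solve-∀

order-positive : ∀ q k → 4 * (suc (suc q) * suc (suc q)) < k * suc (suc q) + 6 * suc (suc q) →
                 0 < k * suc (suc q)
order-positive q (suc k) _ = s≤s z≤n
order-positive q zero hyp = contradiction hyp (≤⇒≯ (begin
  6 * m            ≤⟨ *-monoˡ-≤ m (m≤m+n 6 (2 + 4 * q)) ⟩
  (8 + 4 * q) * m  ≡⟨ regroup q ⟩
  4 * (m * m)      ∎))
  where
  m = suc (suc q)
  open ≤-Reasoning
  regroup : ∀ q → (8 + 4 * q) * suc (suc q) ≡ 4 * (suc (suc q) * suc (suc q))
  regroup = solve-∀

module _ {A : Set} where

  Unique-resp-↭ : ∀ {xs ys : List A} → xs ↭ ys → Unique xs → Unique ys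
  Unique-resp-↭ xs↭ys = ↭ₛ.Unique-resp-↭ (≡.setoid A) (↭⇒↭ₛ xs↭ys)

  Unique-++⁻ʳ : ∀ (xs : List A) {ys} → Unique (xs ++ ys) → Unique ys
  Unique-++⁻ʳ []       u       = u
  Unique-++⁻ʳ (x ∷ xs) (_ ∷ u) = Unique-++⁻ʳ xs u

  Unique-↭-++⁻ʳ : ∀ {zs} (xs : List A) {ys} → zs ↭ xs ++ ys → Unique zs → Unique ys
  Unique-↭-++⁻ʳ xs zs↭ = Unique-++⁻ʳ xs ∘ Unique-resp-↭ zs↭

  ↭-++⇒⊆ : ∀ {zs} (xs : List A) {ys} → zs ↭ xs ++ ys → ys ⊆ zs
  ↭-++⇒⊆ xs zs↭ = ∈-resp-↭ (↭-sym zs↭) ∘ ∈-++⁺ʳ xs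

  ↭-insert-++ : ∀ xs zs {x : A} {ys ws} → x ∷ ys ↭ zs ++ ws → x ∷ xs ++ ys ↭ zs ++ (xs ++ ws)
  ↭-insert-++ xs zs {x} {ys} {ws} x∷ys↭ = begin
    x ∷ xs ++ ys      ↭⟨ shift x xs ys ⟨
    xs ++ x ∷ ys      ↭⟨ ++⁺ˡ xs x∷ys↭ ⟩
    xs ++ zs ++ ws    ↭⟨ shifts xs zs ⟩
    zs ++ xs ++ ws    ∎
    where open PermutationReasoning

  ∈⇒↭∷ : ∀ {x : A} {xs} → x ∈ xs → ∃ λ ys → xs ↭ x ∷ ys
  ∈⇒↭∷ x∈xs with ys , zs , refl ← ∈-∃++ x∈xs = ys ++ zs , shift _ ys zs

  filter-partition-↭ : ∀ {P : A → Set} (P? : ∀ x → Dec (P x)) xs → xs ↭ filter P? xs ++ filter (∁? P?) xs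
  filter-partition-↭ P? xs =
    subst (λ (ys , zs) → xs ↭ ys ++ zs) (partition-defn P? xs) (↭ₛ⇒↭ (↭ₛ.partition-↭ (≡.setoid A) P? xs))

  toVec : ∀ {q} (xs : List A) → length xs ≡ q → Vec A q
  toVec xs eq = cast eq (fromList xs)

  toList-toVec : ∀ {q} (xs : List A) (eq : length xs ≡ q) → toList (toVec xs eq) ≡ xs
  toList-toVec xs eq = trans (toList-cast eq (fromList xs)) (toList∘fromList xs)

  Unique-toList⁻ : ∀ {q} {xs : Vec A q} → Unique (toList xs) → Vec.Unique xs
  Unique-toList⁻ {xs = Vec.[]}     []       = []
  Unique-toList⁻ {xs = x Vec.∷ xs} (x∉ ∷ u) = VecAll.toList⁻ x∉ ∷ Unique-toList⁻ u

  lookup-⤖ : ∀ {q} (xs : Vec A q) → Unique (toList xs) → (∀ y → y ∈ toList xs) → Fin q ⤖ A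
  lookup-⤖ xs u cover = mk⤖ ((λ {i} {j} → VecUnique.lookup-injective (Unique-toList⁻ u) i j) , surjective)
    where
    surjective : ∀ y → ∃ λ i → ∀ {j} → j ≡ i → lookup xs j ≡ y
    surjective y = index y∈xs , λ { refl → sym (lookup-index y∈xs) }
      where y∈xs = Vec∈.∈-toList⁻ (cover y)

module OutDegree {n : ℕ} (T : Tournament n) where

  E? : Decidable (E T)
  E? u v with u ≟ v
  ... | yes refl = no (irrefl T u)
  ... | no u≢v with total T u v u≢v
  ...   | inj₁ uv = yes uv
  ...   | inj₂ vu = no (λ uv → antisym T u v uv vu)

  out-neighbours in-neighbours : Fin n → List (Fin n) → List (Fin n)
  out-neighbours x = filter (E? x)
  in-neighbours x  = filter (∁? (E? x))

  in++out : ∀ x R → R ↭ in-neighbours x R ++ out-neighbours x R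
  in++out x R = ↭-trans (filter-partition-↭ (E? x) R) (++-comm (out-neighbours x R) (in-neighbours x R))

  outdeg : Fin n → List (Fin n) → ℕ
  outdeg x R = length (out-neighbours x R)

  outdeg-∷ : ∀ x y R → outdeg x (y ∷ R) ≡ outdeg x [ y ] + outdeg x R
  outdeg-∷ x y R with E? x y
  ... | yes _ = refl
  ... | no _  = refl

  outdeg-self : ∀ x R → outdeg x (x ∷ R) ≡ outdeg x R
  outdeg-self x R = cong length (filter-reject (E? x) (irrefl T x))

  outdeg-↭ : ∀ x {R R′} → R ↭ R′ → outdeg x R ≡ outdeg x R′
  outdeg-↭ x R↭R′ = ↭-length (filter-↭ (E? x) R↭R′)

  outdeg-↭-∷ : ∀ {x R R₀} → R ↭ x ∷ R₀ → outdeg x R ≡ outdeg x R₀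
  outdeg-↭-∷ {x} {R₀ = R₀} R↭ = trans (outdeg-↭ x R↭) (outdeg-self x R₀)

  outdeg-pair : ∀ {x y} → x ≢ y → outdeg x [ y ] + outdeg y [ x ] ≡ 1
  outdeg-pair {x} {y} x≢y with E? x y | E? y x
  ... | yes xy | yes yx = contradiction yx (antisym T x y xy)
  ... | yes _  | no _   = refl
  ... | no _   | yes _  = refl
  ... | no ¬xy | no ¬yx with total T x y x≢y
  ...   | inj₁ xy = contradiction xy ¬xy
  ...   | inj₂ yx = contradiction yx ¬yx

  arcs : List (Fin n) → List (Fin n) → ℕ
  arcs L R = sum (map (λ x → outdeg x R) L)

  arcs-∷ : ∀ L y R → arcs L (y ∷ R) ≡ arcs L [ y ] + arcs L R
  arcs-∷ []      y R = refl
  arcs-∷ (x ∷ L) y R = begin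
    outdeg x (y ∷ R) + arcs L (y ∷ R)
      ≡⟨ cong₂ _+_ (outdeg-∷ x y R) (arcs-∷ L y R) ⟩
    (outdeg x [ y ] + outdeg x R) + (arcs L [ y ] + arcs L R)
      ≡⟨ interchange (outdeg x [ y ]) (outdeg x R) (arcs L [ y ]) (arcs L R) ⟩
    (outdeg x [ y ] + arcs L [ y ]) + (outdeg x R + arcs L R)
      ∎
    where open ≡-Reasoning

  outdeg+indeg : ∀ {y R} → All (y ≢_) R → outdeg y R + arcs R [ y ] ≡ length R
  outdeg+indeg []                       = refl
  outdeg+indeg {y} {z ∷ R} (y≢z ∷ y∉R) = begin
    outdeg y (z ∷ R) + (outdeg z [ y ] + arcs R [ y ])
      ≡⟨ cong (_+ (outdeg z [ y ] + arcs R [ y ])) (outdeg-∷ y z R) ⟩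
    (outdeg y [ z ] + outdeg y R) + (outdeg z [ y ] + arcs R [ y ])
      ≡⟨ interchange (outdeg y [ z ]) (outdeg y R) (outdeg z [ y ]) (arcs R [ y ]) ⟩
    (outdeg y [ z ] + outdeg z [ y ]) + (outdeg y R + arcs R [ y ])
      ≡⟨ cong₂ _+_ (outdeg-pair y≢z) (outdeg+indeg y∉R) ⟩
    suc (length R)
      ∎
    where open ≡-Reasoning

  handshake : ∀ {R} → Unique R → 2 * arcs R R + length R ≡ length R * length R
  handshake {[]}    []          = refl
  handshake {y ∷ R} (y∉R ∷ uR) = begin
    2 * (outdeg y (y ∷ R) + arcs R (y ∷ R)) + suc l
      ≡⟨ cong (λ a → 2 * a + suc l) (cong₂ _+_ (outdeg-self y R) (arcs-∷ R y R)) ⟩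
    2 * (outdeg y R + (arcs R [ y ] + arcs R R)) + suc l
      ≡⟨ cong (λ a → 2 * a + suc l) (sym (+-assoc (outdeg y R) _ _)) ⟩
    2 * ((outdeg y R + arcs R [ y ]) + arcs R R) + suc l
      ≡⟨ cong (λ d → 2 * (d + arcs R R) + suc l) (outdeg+indeg y∉R) ⟩
    2 * (l + arcs R R) + suc l
      ≡⟨ regroup l (arcs R R) ⟩
    (2 * arcs R R + l) + suc (2 * l)
      ≡⟨ cong (_+ suc (2 * l)) (handshake uR) ⟩
    l * l + suc (2 * l)
      ≡⟨ square l ⟩
    suc l * suc l
      ∎
    where
    open ≡-Reasoning
    l = length R
    regroup : ∀ l a → 2 * (l + a) + suc l ≡ (2 * a + l) + suc (2 * l)
    regroup = solve-∀
    square : ∀ l → l * l + suc (2 * l) ≡ suc l * suc l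
    square = solve-∀

  arcs-bound : ∀ {L R N} → All (λ x → 2 + 2 * outdeg x R ≤ N) L → 2 * arcs L R + 2 * length L ≤ length L * N
  arcs-bound {[]}            []        = z≤n
  arcs-bound {x ∷ L} {R} {N} (hx ∷ hL) = begin
    2 * (outdeg x R + arcs L R) + 2 * suc (length L)   ≡⟨ regroup (outdeg x R) (arcs L R) (length L) ⟩
    (2 + 2 * outdeg x R) + (2 * arcs L R + 2 * length L) ≤⟨ +-mono-≤ hx (arcs-bound {R = R} hL) ⟩
    N + length L * N                                    ∎
    where
    open ≤-Reasoning
    regroup : ∀ d a l → 2 * (d + a) + 2 * suc l ≡ (2 + 2 * d) + (2 * a + 2 * l)
    regroup = solve-∀

  high-outdegree : ∀ {R} → Unique R → 0 < length R → ∃ λ x → x ∈ R × length R ≤ suc (2 * outdeg x R)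
  high-outdegree {R} uR nonempty with any? (λ x → length R ≤? suc (2 * outdeg x R)) R
  ... | yes found = find found
  ... | no none   = contradiction nonempty (≤⇒≯ (+-cancelˡ-≤ (2 * arcs R R + N) N 0 (begin
    (2 * arcs R R + N) + N   ≡⟨ +-assoc (2 * arcs R R) N N ⟩
    2 * arcs R R + (N + N)   ≡⟨ cong (λ t → 2 * arcs R R + (N + t)) (+-identityʳ N) ⟨
    2 * arcs R R + 2 * N     ≤⟨ arcs-bound {R = R} (All.map ≰⇒> (¬Any⇒All¬ R none)) ⟩
    N * N                    ≡⟨ handshake uR ⟨
    2 * arcs R R + N         ≡⟨ +-identityʳ _ ⟨
    (2 * arcs R R + N) + 0   ∎)))
    where
    open ≤-Reasoning
    N = length R

  choose-out-neighbours : ∀ x R k → k ≤ outdeg x R →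
                          ∃₂ λ L R′ → length L ≡ k × All (E T x) L × R ↭ L ++ R′
  choose-out-neighbours x R k k≤d = take k O , drop k O ++ I , length-take-O , take⁺ k (all-filter (E? x) R) , split
    where
    O = out-neighbours x R
    I = in-neighbours x R
    length-take-O : length (take k O) ≡ k
    length-take-O = trans (length-take k O) (m≤n⇒m⊓n≡m k≤d)
    split : R ↭ take k O ++ (drop k O ++ I)
    split = begin
      R                           ↭⟨ filter-partition-↭ (E? x) R ⟩
      O ++ I                      ≡⟨ cong (_++ I) (take++drop≡id k O) ⟨
      (take k O ++ drop k O) ++ I ≡⟨ ++-assoc (take k O) (drop k O) I ⟩
      take k O ++ (drop k O ++ I) ∎
      where open PermutationReasoning

module StarPackings {n : ℕ} (T : Tournament n) (q : ℕ) where
  open OutDegree T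

  p : ℕ
  p = suc q

  record Star : Set where
    constructor star
    field
      centre        : Fin n
      leaves        : List (Fin n)
      length-leaves : length leaves ≡ p
      out           : All (E T centre) leaves
  open Star public

  members : Star → List (Fin n)
  members s = centre s ∷ leaves s

  vertices : List Star → List (Fin n)
  vertices = concatMap members

  length-members-++ : ∀ s R → length (members s ++ R) ≡ suc p + length R
  length-members-++ s R = cong suc (trans (length-++ (leaves s)) (cong (_+ length R) (length-leaves s)))

  length-vertices : ∀ ss → length (vertices ss) ≡ length ss * suc p
  length-vertices []       = refl
  length-vertices (s ∷ ss) = trans (length-members-++ s (vertices ss)) (cong (suc p +_) (length-vertices ss))

  record Packing (R : List (Fin n)) : Set where
    constructor packing
    field
      stars : List Star
      rest  : List (Fin n)
      split : R ↭ vertices stars ++ rest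
  open Packing public

  empty : ∀ R → Packing R
  empty R = packing [] R ↭-refl

  add : ∀ s {R R′} → R ↭ members s ++ R′ → Packing R′ → Packing R
  add s {R} {R′} R↭ (packing ss R″ R′↭) = packing (s ∷ ss) R″ (begin
    R                                 ↭⟨ R↭ ⟩
    members s ++ R′                   ↭⟨ ++⁺ˡ (members s) R′↭ ⟩
    members s ++ (vertices ss ++ R″) ≡⟨ ++-assoc (members s) (vertices ss) R″ ⟨
    vertices (s ∷ ss) ++ R″          ∎)
    where open PermutationReasoning

  _⨾_ : ∀ {R} (P : Packing R) → Packing (rest P) → Packing R
  _⨾_ {R} (packing ss R′ R↭) (packing ts R″ R′↭) = packing (ss ++ ts) R″ (begin
    R                                 ↭⟨ R↭ ⟩
    vertices ss ++ R′                 ↭⟨ ++⁺ˡ (vertices ss) R′↭ ⟩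
    vertices ss ++ (vertices ts ++ R″) ≡⟨ ++-assoc (vertices ss) (vertices ts) R″ ⟨
    (vertices ss ++ vertices ts) ++ R″ ≡⟨ cong (_++ R″) (concatMap-++ members ss ts) ⟨
    vertices (ss ++ ts) ++ R″          ∎)
    where open PermutationReasoning

  _++ʳ_ : ∀ {R} → Packing R → ∀ S → Packing (R ++ S)
  packing ss R′ R↭ ++ʳ S =
    packing ss (R′ ++ S) (↭-trans (++⁺ʳ S R↭) (↭-reflexive (++-assoc (vertices ss) R′ S)))

  length-packing : ∀ {R} (P : Packing R) → length R ≡ length (stars P) * suc p + length (rest P)
  length-packing P = trans (↭-length (split P))
    (trans (length-++ (vertices (stars P))) (cong (_+ length (rest P)) (length-vertices (stars P))))

  rest-⊆ : ∀ {R} (P : Packing R) → rest P ⊆ R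
  rest-⊆ P = ↭-++⇒⊆ (vertices (stars P)) (split P)

  Unique-rest : ∀ {R} (P : Packing R) → Unique R → Unique (rest P)
  Unique-rest P = Unique-↭-++⁻ʳ (vertices (stars P)) (split P)

  length-↭-members : ∀ {R} s R′ → R ↭ members s ++ R′ → length R ≡ suc p + length R′
  length-↭-members s R′ R↭ = trans (↭-length R↭) (length-members-++ s R′)

  remove-star-shorter : ∀ {R} s R′ → R ↭ members s ++ R′ → length R′ < length R
  remove-star-shorter s R′ R↭ =
    subst (length R′ <_) (sym (length-↭-members s R′ R↭)) (s≤s (m≤n+m (length R′) p))

  room-after-star : ∀ {c U} s U′ {a} → c ∷ U ↭ members s ++ U′ → p + a ≤ length U + 2 → a ≤ length U′ + 2
  room-after-star s U′ c∷U↭ room = +-cancelˡ-≤ p _ _ (≤-trans room (≤-reflexive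
    (trans (cong (_+ 2) (suc-injective (length-↭-members s U′ c∷U↭))) (+-assoc p (length U′) 2))))

  star-at : ∀ {x R} → x ∈ R → p ≤ outdeg x R → ∃₂ λ s R′ → R ↭ members s ++ R′
  star-at {x} {R} x∈R p≤d with R₀ , R↭ ← ∈⇒↭∷ x∈R
    with L , R′ , len , out , R₀↭ ← choose-out-neighbours x R₀ p (subst (p ≤_) (outdeg-↭-∷ R↭) p≤d)
    = star x L len out , R′ , ↭-trans R↭ (prep x R₀↭)

  greedy : ∀ {R} → Unique R → Σ (Packing R) λ P → length (rest P) < 2 * p
  greedy {R} = go R (<-wellFounded (length R))
    where
    go : ∀ R → Acc _<_ (length R) → Unique R → Σ (Packing R) λ P → length (rest P) < 2 * p
    go R (acc smaller) uR with length R <? 2 * p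
    ... | yes few = empty R , few
    ... | no many
      with x , x∈R , high ← high-outdegree uR (≤-trans (s≤s z≤n) (≮⇒≥ many))
      with s , R′ , R↭ ← star-at x∈R (2*m≤1+2*n⇒m≤n (≤-trans (≮⇒≥ many) high))
      with P , few ← go R′ (smaller (remove-star-shorter s R′ R↭)) (Unique-↭-++⁻ʳ (members s) R↭ uR)
      = add s R↭ P , few

  module _ {c U} (c∉U : All (c ≢_) U) (uU : Unique U) (few : outdeg c U < p) (room : 3 * p ≤ length U + 2) where
    private
      O I : List (Fin n)
      O = out-neighbours c U
      I = in-neighbours c U

      many-in : suc (2 * q) ≤ length I
      many-in = most-are-in-neighbours q (length I) (length O)
                  (subst (λ l → 3 * p ≤ l + 2) (trans (↭-length (in++out c U)) (length-++ I)) room) (≤-pred few)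

      in-neighbour⟶c : ∀ {w} → w ∈ I → E T w c
      in-neighbour⟶c {w} w∈I with w∈U , ¬c⟶w ← ∈-filter⁻ (∁? (E? c)) w∈I
                              with total T c w (All.lookup c∉U w∈U)
      ... | inj₁ c⟶w = contradiction c⟶w ¬c⟶w
      ... | inj₂ w⟶c = w⟶c

    absorb-into-in-neighbour : ∃₂ λ s U′ → (c ∷ U ↭ members s ++ U′) × U′ ⊆ U
    absorb-into-in-neighbour
      with w , w∈I , high ← high-outdegree (Unique.filter⁺ (∁? (E? c)) uU) (≤-trans (s≤s z≤n) many-in)
      with I₀ , I↭ ← ∈⇒↭∷ w∈I
      with L , I′ , len , out , I₀↭ ← choose-out-neighbours w I₀ q
             (subst (q ≤_) (outdeg-↭-∷ I↭)
               (2*m≤1+2*n⇒m≤n (≤-trans (n≤1+n _) (≤-trans many-in high))))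
      = star w (c ∷ L) (cong suc len) (in-neighbour⟶c w∈I ∷ out) , I′ ++ O ,
        ↭-trans (prep c U↭) (swap c w ↭-refl) , ↭-++⇒⊆ (w ∷ L) U↭
      where
      U↭ : U ↭ w ∷ L ++ (I′ ++ O)
      U↭ = begin
        U                     ↭⟨ in++out c U ⟩
        I ++ O                ↭⟨ ++⁺ʳ O I↭ ⟩
        w ∷ I₀ ++ O           <⟨ ++⁺ʳ O I₀↭ ⟩
        w ∷ (L ++ I′) ++ O    ≡⟨ cong (w ∷_) (++-assoc L I′ O) ⟩
        w ∷ L ++ (I′ ++ O)    ∎
        where open PermutationReasoning

  absorb-one : ∀ {c U} → Unique (c ∷ U) → 3 * p ≤ length U + 2 →
               ∃₂ λ s U′ → (c ∷ U ↭ members s ++ U′) × U′ ⊆ U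
  absorb-one {c} {U} (c∉U ∷ uU) room with p ≤? outdeg c U
  ... | no p≰d = absorb-into-in-neighbour c∉U uU (≰⇒> p≰d) room
  ... | yes p≤d with L , U′ , len , out , U↭ ← choose-out-neighbours c U p p≤d
    = star c L len out , U′ , prep c U↭ , ↭-++⇒⊆ L U↭

  -- Absorbing one vertex needs 3p - 2 vertices of U and uses up p of them.
  absorb : ∀ C {U} → Unique (C ++ U) → (2 + length C) * p ≤ length U + 2 →
           Σ (Packing (C ++ U)) λ P → rest P ⊆ U
  absorb []      {U} _  _    = empty U , id
  absorb (c ∷ C) {U} uR room
    with s , U′ , c∷U↭ , U′⊆U ← absorb-one (Unique-↭-++⁻ʳ C (↭-sym (shift c C U)) uR)
                                  (≤-trans (*-monoˡ-≤ p (m≤m+n 3 (length C))) room)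
    with P , rest⊆U′ ← absorb C (Unique-↭-++⁻ʳ (members s) (↭-insert-++ C (members s) c∷U↭) uR)
                         (room-after-star s U′ c∷U↭ room)
    = add s (↭-insert-++ C (members s) c∷U↭) P , U′⊆U ∘ rest⊆U′

  pack-with-reservoir : ∀ B A → Unique (B ++ A) → (1 + 2 * p) * p ≤ length A + 2 →
                        Σ (Packing (B ++ A)) λ P → rest P ⊆ A × length (rest P) < 2 * p
  pack-with-reservoir B A uBA room
    with PB , few-B ← greedy (Unique-↭-++⁻ʳ A (++-comm B A) uBA)
    with PC , PC⊆A  ← absorb (rest PB) (Unique-rest (PB ++ʳ A) uBA) (≤-trans (*-monoˡ-≤ p (s≤s few-B)) room)
    with PA , few   ← greedy (Unique-rest PC (Unique-rest (PB ++ʳ A) uBA))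
    = (PB ++ʳ A) ⨾ (PC ⨾ PA) , PC⊆A ∘ rest-⊆ PA , few

module StarFactors {k q : ℕ} (T : Tournament (k * suc (suc q))) where
  open StarPackings T q

  members-vec : Star → Vec (Fin (k * suc p)) (suc p)
  members-vec s = centre s Vec.∷ toVec (leaves s) (length-leaves s)

  toList-concat-members : ∀ {j} (S : Vec Star j) → toList (concat (Vec.map members-vec S)) ≡ vertices (toList S)
  toList-concat-members Vec.[]       = refl
  toList-concat-members (s Vec.∷ S) = trans (toList-++ (members-vec s) _)
    (cong₂ (λ L R → centre s ∷ L ++ R) (toList-toVec (leaves s) (length-leaves s)) (toList-concat-members S))

  leaf-edge : ∀ s j → E T (centre s) (lookup (toVec (leaves s) (length-leaves s)) j)
  leaf-edge s = VecAll.lookup⁺ (VecAll.toList⁻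
    (subst (All (E T (centre s))) (sym (toList-toVec (leaves s) (length-leaves s))) (out s)))

  fromStars : (ss : List Star) → length ss ≡ k → allFin (k * suc p) ↭ vertices ss → StarFactor (suc p) k T
  fromStars ss len all↭ = record { place = place ; source = λ _ → zero ; edges = edges }
    where
    S = toVec ss len
    W = Vec.map members-vec S
    toList-W : toList (concat W) ≡ vertices ss
    toList-W = trans (toList-concat-members S) (cong vertices (toList-toVec ss len))
    place : (Fin k × Fin (suc p)) ⤖ Fin (k * suc p)
    place = lookup-⤖ (concat W)
              (subst Unique (sym toList-W) (Unique-resp-↭ all↭ (Unique.allFin⁺ _)))
              (λ y → subst (y ∈_) (sym toList-W) (∈-resp-↭ all↭ (∈-allFin y)))
            ⤖-∘ ↔⇒⤖ (↔-sym *↔×)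
    at : ∀ i j → lookup (concat W) (combine i j) ≡ lookup (members-vec (lookup S i)) j
    at i j = trans (lookup-concat W i j) (cong (λ v → lookup v j) (lookup-map i members-vec S))
    edges : ∀ i j → j ≢ zero → E T (lookup (concat W) (combine i zero)) (lookup (concat W) (combine i j))
    edges i zero    j≢0 = contradiction refl j≢0
    edges i (suc j) _   = subst₂ (E T) (sym (at i zero)) (sym (at i (suc j))) (leaf-edge (lookup S i) j)

module Construction {q k : ℕ} (T : Tournament (k * suc (suc q))) where
  open OutDegree T
  open StarPackings T q
  open StarFactors {k} {q} T

  length-V : length (allFin (k * suc p)) ≡ k * suc p
  length-V = length-tabulate id

  close-with-centre : ∀ {u R A} → allFin (k * suc p) ↭ u ∷ R → All (E T u) A →
                      (Σ (Packing R) λ P → rest P ⊆ A × length (rest P) < 2 * p) → StarFactor (suc p) k T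
  close-with-centre {u} V↭ u⟶A (P , rest⊆A , few) =
    finish (one-star-left p (length (stars P)) k (length (rest P)) count few)
    where
    count : suc (length (stars P) * suc p + length (rest P)) ≡ k * suc p
    count = trans (cong suc (sym (length-packing P))) (trans (sym (↭-length V↭)) length-V)
    finish : length (rest P) ≡ p × suc (length (stars P)) ≡ k → StarFactor (suc p) k T
    finish (len-rest , len-stars) = fromStars (star u (rest P) len-rest (anti-mono rest⊆A u⟶A) ∷ stars P) len-stars
      (↭-trans V↭ (prep u (↭-trans (split P) (++-comm (vertices (stars P)) (rest P)))))

  starFactor : 4 * (suc p * suc p) < k * suc p + 6 * suc p → StarFactor (suc p) k T
  starFactor hyp
    with u , u∈V , u-wins ← high-outdegree (Unique.allFin⁺ _) (subst (0 <_) (sym length-V) (order-positive q k hyp))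
    with R , V↭ ← ∈⇒↭∷ u∈V
    -- Abstracting the packing with another `with` would make Agda unfold the well-founded
    -- recursion of greedy, so it is handed to close-with-centre as an argument instead.
    = close-with-centre (↭-trans V↭ (prep u (in++out u R))) (all-filter (E? u) R)
        (pack-with-reservoir (in-neighbours u R) (out-neighbours u R)
          (Unique-resp-↭ (in++out u R) (Unique-↭-++⁻ʳ [ u ] V↭ (Unique.allFin⁺ _)))
          (absorption-room p k (outdeg u R) hyp
            (subst₂ (λ N d → N ≤ suc (2 * d)) length-V (outdeg-↭-∷ V↭) u-wins)))

theorem2 : (m k : ℕ) → m ≥ 2 → k * m + 6 * m > 4 * (m * m) →
    (T : Tournament (k * m)) → StarFactor m k T
theorem2 (suc zero)    k (s≤s ()) _   _
theorem2 (suc (suc q)) k _        hyp T = Construction.starFactor T hyp
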